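{- For any finite simple graphs $G$ and $H$, $$\rho(G\square H)\leq \min\{\rho(G)|V(H)|,\ \rho(H)|V(G)|\}.$$ Moreover, this bound is sharp: for instance, $\rho(P_2\square K_{m,n})=2$ whenever $m+n\geq 3$, which attains the bound.
   Context: For a graph $G$ and $v\in V(G)$, $N_G[v]$ is the closed neighborhood of $v$. A set $P\subseteq V(G)$ is a packing if $N_G[u]\cap N_G[v]=\emptyset$ for all distinct $u,v\in P$; the packing number $\rho(G)$ is the maximum cardinality of a packing. The Cartesian product $G\square H$ has vertex set $V(G)\times V(H)$, with $(g,h)$ adjacent to $(g',h')$ iff either $g=g'$ and $hh'\in E(H)$, or $h=h'$ and $gg'\in E(G)$. $P_2$ is the path on two vertices and $K_{m,n}$ the complete bipartite graph. -}

module Defs where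

open import Data.Nat using (ℕ; zero; suc; _*_; _+_; _≤_)
open import Data.Fin using (Fin; remQuot; splitAt; zero; suc)
open import Data.Fin.Subset using (Subset; _∈_; ∣_∣)
open import Data.Product using (_×_; _,_; proj₁; proj₂; ∃)
open import Data.Sum using (_⊎_; inj₁; inj₂)
open import Data.Bool using (Bool; true; false)
open import Data.Unit using (⊤; tt)
open import Data.Empty using (⊥)
open import Relation.Nullary using (¬_)
open import Relation.Binary.PropositionalEquality using (_≡_; refl) renaming (sym to ≡-sym)
open import Level using (0ℓ)

record Graph : Set₁ where
  field
    order : ℕ
    Adj   : Fin order → Fin order → Set
    sym   : ∀ {u v} → Adj u v → Adj v u
    irrefl : ∀ {u} → ¬ Adj u u
open Graph public

∣V∣ : Graph → ℕ
∣V∣ G = order G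

InClosedNbhd : (G : Graph) → Fin (order G) → Fin (order G) → Set
InClosedNbhd G v w = (w ≡ v) ⊎ Adj G v w

IsPacking : (G : Graph) → Subset (order G) → Set
IsPacking G P = ∀ u v → u ∈ P → v ∈ P → ¬ (u ≡ v) →
  ∀ w → ¬ (InClosedNbhd G u w × InClosedNbhd G v w)

PackingNumber : Graph → ℕ → Set
PackingNumber G k =
  (∃ λ P → IsPacking G P × ∣ P ∣ ≡ k) × (∀ P → IsPacking G P → ∣ P ∣ ≤ k)

-- Cartesian product G □ H, vertex (g,h) encoded as combine g h : Fin (|G| * |H|)
PairAdj : (G H : Graph) → Fin (order G) × Fin (order H) → Fin (order G) × Fin (order H) → Set
PairAdj G H (g , h) (g' , h') = ((g ≡ g') × Adj H h h') ⊎ ((h ≡ h') × Adj G g g')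

ProdAdj : (G H : Graph) → Fin (order G * order H) → Fin (order G * order H) → Set
ProdAdj G H x y = PairAdj G H (remQuot (order H) x) (remQuot (order H) y)

private
  pairSym : (G H : Graph) → ∀ p q → PairAdj G H p q → PairAdj G H q p
  pairSym G H (g , h) (g' , h') (inj₁ (e , a)) = inj₁ (≡-sym e , sym H a)
  pairSym G H (g , h) (g' , h') (inj₂ (e , a)) = inj₂ (≡-sym e , sym G a)

  pairIrr : (G H : Graph) → ∀ p → ¬ PairAdj G H p p
  pairIrr G H (g , h) (inj₁ (_ , a)) = irrefl H a
  pairIrr G H (g , h) (inj₂ (_ , a)) = irrefl G a

_□_ : Graph → Graph → Graph
G □ H = record
  { order = order G * order H
  ; Adj = ProdAdj G H
  ; sym = λ {x} {y} → pairSym G H (remQuot (order H) x) (remQuot (order H) y)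
  ; irrefl = λ {x} → pairIrr G H (remQuot (order H) x)
  }

P₂Adj : Fin 2 → Fin 2 → Set
P₂Adj zero (suc zero) = ⊤
P₂Adj (suc zero) zero = ⊤
P₂Adj _ _ = ⊥

private
  p2sym : ∀ {u v} → P₂Adj u v → P₂Adj v u
  p2sym {zero} {suc zero} _ = tt
  p2sym {suc zero} {zero} _ = tt

  p2irr : ∀ {u} → ¬ P₂Adj u u
  p2irr {zero} ()
  p2irr {suc zero} ()

P₂ : Graph
P₂ = record { order = 2 ; Adj = P₂Adj ; sym = λ {u} {v} → p2sym {u} {v} ; irrefl = λ {u} → p2irr {u} }

-- K_{m,n} on Fin (m + n): the first m vertices form one side, the last n the other;
-- u ~ v iff they lie on different sides.
Side : ∀ m {n} → Fin (m + n) → Bool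
Side m v with splitAt m v
... | inj₁ _ = false
... | inj₂ _ = true

KAdj : ∀ m n → Fin (m + n) → Fin (m + n) → Set
KAdj m n u v = ¬ (Side m u ≡ Side m v)

K : ℕ → ℕ → Graph
K m n = record
  { order = m + n
  ; Adj = KAdj m n
  ; sym = λ ne e → ne (≡-sym e)
  ; irrefl = λ ne → ne refl
  }

-- Restricted to a fibre {g} × V(H) or V(G) × {h}, the closed neighbourhoods of the product
-- contain those of the factor, so every fibre of a packing of G □ H is a packing of the factor.
-- Summing over the |V(G)| fibres of the first kind bounds ρ(G □ H) by |V(G)| ρ(H), and over
-- those of the second kind by |V(H)| ρ(G).
-- For sharpness, P₂ and K_{m,n} (m, n ≥ 1) have diameter at most 2, so both have packing
-- number 1 and the bound is 2; it is attained by {(0, a), (1, b)} for two distinct vertices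
-- a, b on the same side of K_{m,n}, whose closed neighbourhoods could only meet if a ~ b.
module Submission where

open import Defs
open import Data.Nat using (ℕ; _*_; _+_; _≤_; _<_; _⊓_; zero; suc; z≤n; s≤s)
open import Data.Nat.Properties
  using (+-0-commutativeMonoid; +-mono-≤; +-assoc; *-comm; *-identityˡ; ⊓-glb; m≥n⇒m⊓n≡n;
         n≤1+n; ≤-antisym; ≤-trans; ≤-reflexive; module ≤-Reasoning)
open import Data.Bool using (Bool; true; false; not)
open import Data.Bool.Properties using (not-¬) renaming (_≟_ to _≟ᵇ_)
open import Data.Fin using (Fin; zero; suc; combine; remQuot; _↑ˡ_; _↑ʳ_)
open import Data.Fin.Properties using (_≟_; remQuot-combine; combine-injective; splitAt-↑ʳ)
open import Data.Fin.Subset using (Subset; _∈_; _∪_; ∣_∣; ⁅_⁆)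
open import Data.Fin.Subset.Properties
  using (x∈⁅y⁆⇒x≡y; x∈⁅x⁆; ∣⁅x⁆∣≡1; p⊆q⇒∣p∣≤∣q∣; p⊂q⇒∣p∣<∣q∣; p⊆p∪q; q⊆p∪q; x∈p∪q⁻;
         nonempty?; Empty-unique; ∣⊥∣≡0)
open import Data.Vec using (lookup; tabulate)
open import Data.Vec.Properties using ([]=⇒lookup; lookup⇒[]=; lookup∘tabulate; tabulate∘lookup)
open import Data.Product using (_×_; _,_; proj₁; proj₂; ∃; Σ-syntax)
open import Data.Sum using (_⊎_; inj₁; inj₂)
open import Data.Empty using (⊥-elim)
open import Data.Unit using (tt)
open import Relation.Nullary using (¬_; yes; no)
open import Relation.Binary.PropositionalEquality
  using (_≡_; _≢_; refl; cong; cong₂; subst; subst₂; trans; module ≡-Reasoning)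
  renaming (sym to ≡-sym)
open import Function using (_∘_)
open import Algebra.Properties.CommutativeMonoid.Sum +-0-commutativeMonoid
  using (sum-syntax; sum-cong-≗; ∑-comm)

indicator : Bool → ℕ
indicator true  = 1
indicator false = 0

∑-splitAt : ∀ m n (f : Fin (m + n) → ℕ) →
  ∑[ i < m + n ] f i ≡ ∑[ i < m ] f (i ↑ˡ n) + ∑[ j < n ] f (m ↑ʳ j)
∑-splitAt zero    n f = refl
∑-splitAt (suc m) n f =
  trans (cong (f zero +_) (∑-splitAt m n (f ∘ suc))) (≡-sym (+-assoc (f zero) _ _))

∑-combine : ∀ m n (f : Fin (m * n) → ℕ) →
  ∑[ x < m * n ] f x ≡ ∑[ i < m ] ∑[ j < n ] f (combine i j)
∑-combine zero    n f = refl
∑-combine (suc m) n f =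
  trans (∑-splitAt n (m * n) f) (cong (∑[ j < n ] f (j ↑ˡ (m * n)) +_) (∑-combine m n (f ∘ (n ↑ʳ_))))

∑-≤-* : ∀ n {k} (f : Fin n → ℕ) → (∀ i → f i ≤ k) → ∑[ i < n ] f i ≤ n * k
∑-≤-* zero    f f≤k = z≤n
∑-≤-* (suc n) f f≤k = +-mono-≤ (f≤k zero) (∑-≤-* n (f ∘ suc) (f≤k ∘ suc))

∣tabulate∣≡∑ : ∀ n (f : Fin n → Bool) → ∣ tabulate f ∣ ≡ ∑[ i < n ] indicator (f i)
∣tabulate∣≡∑ zero    f = refl
∣tabulate∣≡∑ (suc n) f with f zero
... | true  = cong suc (∣tabulate∣≡∑ n (f ∘ suc))
... | false = ∣tabulate∣≡∑ n (f ∘ suc)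

∈-tabulate-lookup : ∀ {m n} (p : Subset m) (f : Fin n → Fin m) {x} →
  x ∈ tabulate (lookup p ∘ f) → f x ∈ p
∈-tabulate-lookup p f {x} x∈ =
  lookup⇒[]= (f x) p (trans (≡-sym (lookup∘tabulate (lookup p ∘ f) x)) ([]=⇒lookup x∈))

row : ∀ {m} n → Subset (m * n) → Fin m → Subset n
row n P g = tabulate (λ h → lookup P (combine g h))

column : ∀ m {n} → Subset (m * n) → Fin n → Subset m
column m P h = tabulate (λ g → lookup P (combine g h))

∣p∣≡∑∣row∣ : ∀ m n (P : Subset (m * n)) → ∣ P ∣ ≡ ∑[ g < m ] ∣ row n P g ∣
∣p∣≡∑∣row∣ m n P = begin
  ∣ P ∣                                  ≡⟨ cong ∣_∣ (≡-sym (tabulate∘lookup P)) ⟩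
  ∣ tabulate (lookup P) ∣                ≡⟨ ∣tabulate∣≡∑ (m * n) (lookup P) ⟩
  ∑[ x < m * n ] χ x                     ≡⟨ ∑-combine m n χ ⟩
  ∑[ g < m ] ∑[ h < n ] χ (combine g h)  ≡⟨ sum-cong-≗ {m} (λ g → ≡-sym (∣row∣≡∑ g)) ⟩
  ∑[ g < m ] ∣ row n P g ∣               ∎
  where
  open ≡-Reasoning
  χ : Fin (m * n) → ℕ
  χ = indicator ∘ lookup P
  ∣row∣≡∑ : ∀ g → ∣ row n P g ∣ ≡ ∑[ h < n ] χ (combine g h)
  ∣row∣≡∑ g = ∣tabulate∣≡∑ n (lookup P ∘ combine g)

∣p∣≡∑∣column∣ : ∀ m n (P : Subset (m * n)) → ∣ P ∣ ≡ ∑[ h < n ] ∣ column m P h ∣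
∣p∣≡∑∣column∣ m n P = begin
  ∣ P ∣                        ≡⟨ ∣p∣≡∑∣row∣ m n P ⟩
  ∑[ g < m ] ∣ row n P g ∣     ≡⟨ sum-cong-≗ {m} (λ g → ∣tabulate∣≡∑ n (lookup P ∘ combine g)) ⟩
  ∑[ g < m ] ∑[ h < n ] χ g h  ≡⟨ ∑-comm χ ⟩
  ∑[ h < n ] ∑[ g < m ] χ g h  ≡⟨ sum-cong-≗ {n} (λ h → ≡-sym (∣column∣≡∑ h)) ⟩
  ∑[ h < n ] ∣ column m P h ∣  ∎
  where
  open ≡-Reasoning
  χ : Fin m → Fin n → ℕ
  χ g h = indicator (lookup P (combine g h))
  ∣column∣≡∑ : ∀ h → ∣ column m P h ∣ ≡ ∑[ g < m ] χ g h
  ∣column∣≡∑ h = ∣tabulate∣≡∑ m (λ g → lookup P (combine g h))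

□-adj : ∀ G H {g g' h h'} →
  PairAdj G H (g , h) (g' , h') → Adj (G □ H) (combine g h) (combine g' h')
□-adj G H {g} {g'} {h} {h'} =
  subst₂ (PairAdj G H) (≡-sym (remQuot-combine g h)) (≡-sym (remQuot-combine g' h'))

closedNbhd-□ˡ : ∀ G H {g w : Fin (order G)} (h : Fin (order H)) →
  InClosedNbhd G g w → InClosedNbhd (G □ H) (combine g h) (combine w h)
closedNbhd-□ˡ G H h (inj₁ refl) = inj₁ refl
closedNbhd-□ˡ G H h (inj₂ g~w)  = inj₂ (□-adj G H (inj₂ (refl , g~w)))

closedNbhd-□ʳ : ∀ G H (g : Fin (order G)) {h w : Fin (order H)} →
  InClosedNbhd H h w → InClosedNbhd (G □ H) (combine g h) (combine g w)
closedNbhd-□ʳ G H g (inj₁ refl) = inj₁ refl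
closedNbhd-□ʳ G H g (inj₂ h~w)  = inj₂ (□-adj G H (inj₁ (refl , h~w)))

row-isPacking : ∀ G H {P} → IsPacking (G □ H) P →
  ∀ (g : Fin (order G)) → IsPacking H (row (order H) P g)
row-isPacking G H {P} P-packing g u v u∈ v∈ u≢v w (u~w , v~w) =
  P-packing (combine g u) (combine g v)
    (∈-tabulate-lookup P (combine g) u∈) (∈-tabulate-lookup P (combine g) v∈)
    (u≢v ∘ proj₂ ∘ combine-injective g u g v)
    (combine g w) (closedNbhd-□ʳ G H g u~w , closedNbhd-□ʳ G H g v~w)

column-isPacking : ∀ G H {P} → IsPacking (G □ H) P →
  ∀ (h : Fin (order H)) → IsPacking G (column (order G) P h)
column-isPacking G H {P} P-packing h u v u∈ v∈ u≢v w (u~w , v~w) =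
  P-packing (combine u h) (combine v h)
    (∈-tabulate-lookup P (λ g → combine g h) u∈) (∈-tabulate-lookup P (λ g → combine g h) v∈)
    (u≢v ∘ proj₁ ∘ combine-injective u h v h)
    (combine w h) (closedNbhd-□ˡ G H h u~w , closedNbhd-□ˡ G H h v~w)

□-packing-≤ʳ : ∀ G H {P s} → IsPacking (G □ H) P → (∀ Q → IsPacking H Q → ∣ Q ∣ ≤ s) →
  ∣ P ∣ ≤ order G * s
□-packing-≤ʳ G H {P} {s} P-packing H-bound = begin
  ∣ P ∣
    ≡⟨ ∣p∣≡∑∣row∣ (order G) (order H) P ⟩
  ∑[ g < order G ] ∣ row (order H) P g ∣
    ≤⟨ ∑-≤-* (order G) _ (λ g → H-bound _ (row-isPacking G H P-packing g)) ⟩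
  order G * s
    ∎
  where open ≤-Reasoning

□-packing-≤ˡ : ∀ G H {P r} → IsPacking (G □ H) P → (∀ Q → IsPacking G Q → ∣ Q ∣ ≤ r) →
  ∣ P ∣ ≤ order H * r
□-packing-≤ˡ G H {P} {r} P-packing G-bound = begin
  ∣ P ∣
    ≡⟨ ∣p∣≡∑∣column∣ (order G) (order H) P ⟩
  ∑[ h < order H ] ∣ column (order G) P h ∣
    ≤⟨ ∑-≤-* (order H) _ (λ h → G-bound _ (column-isPacking G H P-packing h)) ⟩
  order H * r
    ∎
  where open ≤-Reasoning

packingNumber-□-≤ : (G H : Graph) (r s t : ℕ) →
  PackingNumber G r → PackingNumber H s → PackingNumber (G □ H) t →
  t ≤ (r * ∣V∣ H) ⊓ (s * ∣V∣ G)
packingNumber-□-≤ G H r s t (_ , G-bound) (_ , H-bound) ((P , P-packing , refl) , _) =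
  ⊓-glb (subst (∣ P ∣ ≤_) (*-comm (order H) r) (□-packing-≤ˡ G H P-packing G-bound))
        (subst (∣ P ∣ ≤_) (*-comm (order G) s) (□-packing-≤ʳ G H P-packing H-bound))

packingNumber-unique : ∀ G {r s} → PackingNumber G r → PackingNumber G s → r ≡ s
packingNumber-unique G ((P , P-packing , refl) , r-bound) ((Q , Q-packing , refl) , s-bound) =
  ≤-antisym (s-bound P P-packing) (r-bound Q Q-packing)

packingNumber-intro : ∀ G {P k} → IsPacking G P → k ≤ ∣ P ∣ →
  (∀ Q → IsPacking G Q → ∣ Q ∣ ≤ k) → PackingNumber G k
packingNumber-intro G {P} P-packing k≤∣P∣ bound =
  (P , P-packing , ≤-antisym (bound P P-packing) k≤∣P∣) , bound

∣p∣≤1 : ∀ {n} (p : Subset n) → (∀ {x y} → x ∈ p → y ∈ p → x ≡ y) → ∣ p ∣ ≤ 1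
∣p∣≤1 {n} p all-equal with nonempty? p
... | yes (x , x∈p) = subst (∣ p ∣ ≤_) (∣⁅x⁆∣≡1 x)
      (p⊆q⇒∣p∣≤∣q∣ (λ y∈p → subst (_∈ ⁅ x ⁆) (all-equal x∈p y∈p) (x∈⁅x⁆ x)))
... | no p-empty = subst (_≤ 1) (≡-sym (trans (cong ∣_∣ (Empty-unique p-empty)) (∣⊥∣≡0 n))) z≤n

∈⁅x⁆∪⁅y⁆⁻ : ∀ {n} {x y u : Fin n} → u ∈ ⁅ x ⁆ ∪ ⁅ y ⁆ → u ≡ x ⊎ u ≡ y
∈⁅x⁆∪⁅y⁆⁻ {x = x} {y} u∈ with x∈p∪q⁻ ⁅ x ⁆ ⁅ y ⁆ u∈
... | inj₁ u∈⁅x⁆ = inj₁ (x∈⁅y⁆⇒x≡y x u∈⁅x⁆)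
... | inj₂ u∈⁅y⁆ = inj₂ (x∈⁅y⁆⇒x≡y y u∈⁅y⁆)

2≤∣⁅x⁆∪⁅y⁆∣ : ∀ {n} {x y : Fin n} → x ≢ y → 2 ≤ ∣ ⁅ x ⁆ ∪ ⁅ y ⁆ ∣
2≤∣⁅x⁆∪⁅y⁆∣ {x = x} {y} x≢y = subst (_< ∣ ⁅ x ⁆ ∪ ⁅ y ⁆ ∣) (∣⁅x⁆∣≡1 x)
  (p⊂q⇒∣p∣<∣q∣ (p⊆p∪q ⁅ y ⁆ , y , q⊆p∪q ⁅ x ⁆ ⁅ y ⁆ (x∈⁅x⁆ y) ,
                λ y∈⁅x⁆ → x≢y (≡-sym (x∈⁅y⁆⇒x≡y x y∈⁅x⁆))))

⁅x⁆-isPacking : ∀ G (x : Fin (order G)) → IsPacking G ⁅ x ⁆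
⁅x⁆-isPacking G x u v u∈ v∈ u≢v w _ = u≢v (trans (x∈⁅y⁆⇒x≡y x u∈) (≡-sym (x∈⁅y⁆⇒x≡y x v∈)))

ClosedNbhdsDisjoint : (G : Graph) → Fin (order G) → Fin (order G) → Set
ClosedNbhdsDisjoint G x y = ∀ w → ¬ (InClosedNbhd G x w × InClosedNbhd G y w)

⁅x⁆∪⁅y⁆-isPacking : ∀ G {x y} → ClosedNbhdsDisjoint G x y → IsPacking G (⁅ x ⁆ ∪ ⁅ y ⁆)
⁅x⁆∪⁅y⁆-isPacking G disjoint u v u∈ v∈ u≢v with ∈⁅x⁆∪⁅y⁆⁻ u∈ | ∈⁅x⁆∪⁅y⁆⁻ v∈
... | inj₁ refl | inj₁ refl = ⊥-elim (u≢v refl)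
... | inj₁ refl | inj₂ refl = disjoint
... | inj₂ refl | inj₁ refl = λ w (y~w , x~w) → disjoint w (x~w , y~w)
... | inj₂ refl | inj₂ refl = ⊥-elim (u≢v refl)

closedNbhdsDisjoint⇒≢ : ∀ G {x y} → ClosedNbhdsDisjoint G x y → x ≢ y
closedNbhdsDisjoint⇒≢ G {x} disjoint x≡y = disjoint x (inj₁ refl , inj₁ x≡y)

Diameter≤2 : Graph → Set
Diameter≤2 G = ∀ u v → ∃ λ w → InClosedNbhd G u w × InClosedNbhd G v w

Diameter≤2⇒packing≤1 : ∀ G → Diameter≤2 G → ∀ P → IsPacking G P → ∣ P ∣ ≤ 1
Diameter≤2⇒packing≤1 G diam P P-packing = ∣p∣≤1 P all-equal
  where
  all-equal : ∀ {x y} → x ∈ P → y ∈ P → x ≡ y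
  all-equal {x} {y} x∈ y∈ with x ≟ y
  ... | yes x≡y = x≡y
  ... | no x≢y  = ⊥-elim (P-packing x y x∈ y∈ x≢y (proj₁ (diam x y)) (proj₂ (diam x y)))

Diameter≤2⇒packingNumber≡1 : ∀ G → Diameter≤2 G → Fin (order G) → PackingNumber G 1
Diameter≤2⇒packingNumber≡1 G diam x =
  packingNumber-intro G (⁅x⁆-isPacking G x) (≤-reflexive (≡-sym (∣⁅x⁆∣≡1 x)))
    (Diameter≤2⇒packing≤1 G diam)

P₂-diameter≤2 : Diameter≤2 P₂
P₂-diameter≤2 u v = zero , near-zero u , near-zero v
  where
  near-zero : ∀ u → InClosedNbhd P₂ u zero
  near-zero zero       = inj₁ refl
  near-zero (suc zero) = inj₂ tt

K-vertexOnSide : ∀ {m n} → 1 ≤ m → 1 ≤ n → ∀ b → ∃ λ (w : Fin (m + n)) → Side m w ≡ b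
K-vertexOnSide {suc m} {n} _ _ false = zero ↑ˡ n , refl
K-vertexOnSide {m} {suc n} _ _ true  = m ↑ʳ zero , Side-↑ʳ zero
  where
  Side-↑ʳ : ∀ j → Side m (m ↑ʳ j) ≡ true
  Side-↑ʳ j rewrite splitAt-↑ʳ m (suc n) j = refl

K-diameter≤2 : ∀ {m n} → 1 ≤ m → 1 ≤ n → Diameter≤2 (K m n)
K-diameter≤2 {m} 1≤m 1≤n u v with Side m u ≟ᵇ Side m v
... | no u~v = v , inj₂ u~v , inj₁ refl
... | yes same with K-vertexOnSide 1≤m 1≤n (not (Side m u))
...   | w , w-side =
  w , inj₂ (λ e → not-¬ refl (trans e w-side)) , inj₂ (λ e → not-¬ (≡-sym same) (trans e w-side))

packingNumber-P₂≡1 : PackingNumber P₂ 1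
packingNumber-P₂≡1 = Diameter≤2⇒packingNumber≡1 P₂ P₂-diameter≤2 zero

packingNumber-K≡1 : ∀ {m n} → 1 ≤ m → 1 ≤ n → PackingNumber (K m n) 1
packingNumber-K≡1 {m} {n} 1≤m 1≤n =
  Diameter≤2⇒packingNumber≡1 (K m n) (K-diameter≤2 1≤m 1≤n) (proj₁ (K-vertexOnSide 1≤m 1≤n false))

K-nonadjacentPair : ∀ m n → 3 ≤ m + n →
  Σ[ a ∈ Fin (m + n) ] Σ[ b ∈ Fin (m + n) ] a ≢ b × ¬ Adj (K m n) a b
K-nonadjacentPair (suc (suc m)) n          _ = zero , suc zero , (λ ()) , λ a~b → a~b refl
K-nonadjacentPair (suc zero) (suc (suc n)) _ = suc zero , suc (suc zero) , (λ ()) , λ a~b → a~b refl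
K-nonadjacentPair zero (suc (suc n))       _ = zero , suc zero , (λ ()) , λ a~b → a~b refl
K-nonadjacentPair (suc zero) (suc zero) (s≤s (s≤s ()))
K-nonadjacentPair (suc zero) zero (s≤s ())
K-nonadjacentPair zero (suc zero) (s≤s ())
K-nonadjacentPair zero zero ()

PairClosedNbhd : (G H : Graph) →
  Fin (order G) × Fin (order H) → Fin (order G) × Fin (order H) → Set
PairClosedNbhd G H p q = q ≡ p ⊎ PairAdj G H p q

closedNbhd-□⁻ : ∀ G H (g : Fin (order G)) (h : Fin (order H)) {w} →
  InClosedNbhd (G □ H) (combine g h) w → PairClosedNbhd G H (g , h) (remQuot (order H) w)
closedNbhd-□⁻ G H g h (inj₁ refl) = inj₁ (remQuot-combine g h)
closedNbhd-□⁻ G H g h (inj₂ adj)  = inj₂ (subst (λ p → PairAdj G H p _) (remQuot-combine g h) adj)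

pairClosedNbhds-meet⇒adj : ∀ G H {g g' h h'} p → g ≢ g' → h ≢ h' →
  PairClosedNbhd G H (g , h) p → PairClosedNbhd G H (g' , h') p → Adj G g g' × Adj H h h'
pairClosedNbhds-meet⇒adj G H _ g≢g' h≢h' (inj₁ refl) (inj₁ e) = ⊥-elim (g≢g' (cong proj₁ e))
pairClosedNbhds-meet⇒adj G H _ g≢g' h≢h' (inj₁ refl) (inj₂ (inj₁ (g'≡g , _))) =
  ⊥-elim (g≢g' (≡-sym g'≡g))
pairClosedNbhds-meet⇒adj G H _ g≢g' h≢h' (inj₁ refl) (inj₂ (inj₂ (h'≡h , _))) =
  ⊥-elim (h≢h' (≡-sym h'≡h))
pairClosedNbhds-meet⇒adj G H _ g≢g' h≢h' (inj₂ (inj₁ (refl , _))) (inj₁ e) =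
  ⊥-elim (g≢g' (cong proj₁ e))
pairClosedNbhds-meet⇒adj G H _ g≢g' h≢h' (inj₂ (inj₁ (refl , _))) (inj₂ (inj₁ (g'≡g , _))) =
  ⊥-elim (g≢g' (≡-sym g'≡g))
pairClosedNbhds-meet⇒adj G H _ g≢g' h≢h' (inj₂ (inj₁ (refl , h~h'))) (inj₂ (inj₂ (refl , g'~g))) =
  sym G g'~g , h~h'
pairClosedNbhds-meet⇒adj G H _ g≢g' h≢h' (inj₂ (inj₂ (refl , _))) (inj₁ e) =
  ⊥-elim (h≢h' (cong proj₂ e))
pairClosedNbhds-meet⇒adj G H _ g≢g' h≢h' (inj₂ (inj₂ (refl , g~g'))) (inj₂ (inj₁ (refl , h'~h))) =
  g~g' , sym H h'~h
pairClosedNbhds-meet⇒adj G H _ g≢g' h≢h' (inj₂ (inj₂ (refl , _))) (inj₂ (inj₂ (h'≡h , _))) =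
  ⊥-elim (h≢h' (≡-sym h'≡h))

□-closedNbhdsDisjoint : ∀ G H {g g' h h'} → g ≢ g' → h ≢ h' → ¬ (Adj G g g' × Adj H h h') →
  ClosedNbhdsDisjoint (G □ H) (combine g h) (combine g' h')
□-closedNbhdsDisjoint G H {g} {g'} {h} {h'} g≢g' h≢h' ¬adj w (gh~w , g'h'~w) =
  ¬adj (pairClosedNbhds-meet⇒adj G H (remQuot (order H) w) g≢g' h≢h'
         (closedNbhd-□⁻ G H g h gh~w) (closedNbhd-□⁻ G H g' h' g'h'~w))

packingNumber-P₂□K≡2 : ∀ m n → 1 ≤ m → 1 ≤ n → 3 ≤ m + n → PackingNumber (P₂ □ K m n) 2
packingNumber-P₂□K≡2 m n 1≤m 1≤n 3≤m+n with K-nonadjacentPair m n 3≤m+n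
... | a , b , a≢b , a≁b =
  packingNumber-intro (P₂ □ K m n) (⁅x⁆∪⁅y⁆-isPacking (P₂ □ K m n) disjoint)
    (2≤∣⁅x⁆∪⁅y⁆∣ (closedNbhdsDisjoint⇒≢ (P₂ □ K m n) disjoint))
    (λ Q Q-packing → □-packing-≤ʳ P₂ (K m n) Q-packing
                       (Diameter≤2⇒packing≤1 (K m n) (K-diameter≤2 1≤m 1≤n)))
  where
  disjoint : ClosedNbhdsDisjoint (P₂ □ K m n) (combine {2} zero a) (combine {2} (suc zero) b)
  disjoint = □-closedNbhdsDisjoint P₂ (K m n) {g = zero} {g' = suc zero} (λ ()) a≢b (a≁b ∘ proj₂)

proposition2 : ((G H : Graph) → (r s t : ℕ) →
    PackingNumber G r → PackingNumber H s → PackingNumber (G □ H) t →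
    t ≤ (r * ∣V∣ H) ⊓ (s * ∣V∣ G))
    ×
    ((m n : ℕ) → 1 ≤ m → 1 ≤ n → 3 ≤ m + n →
    PackingNumber (P₂ □ K m n) 2
    × ((r s : ℕ) → PackingNumber P₂ r → PackingNumber (K m n) s →
    (r * ∣V∣ (K m n)) ⊓ (s * ∣V∣ P₂) ≡ 2))
proposition2 = packingNumber-□-≤ , λ m n 1≤m 1≤n 3≤m+n →
  packingNumber-P₂□K≡2 m n 1≤m 1≤n 3≤m+n , λ r s ρ[P₂]≡r ρ[K]≡s →
  let open ≡-Reasoning in begin
    (r * (m + n)) ⊓ (s * 2)
      ≡⟨ cong₂ (λ r s → (r * (m + n)) ⊓ (s * 2))
           (packingNumber-unique P₂ ρ[P₂]≡r packingNumber-P₂≡1)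
           (packingNumber-unique (K m n) ρ[K]≡s (packingNumber-K≡1 1≤m 1≤n)) ⟩
    (1 * (m + n)) ⊓ 2
      ≡⟨ m≥n⇒m⊓n≡n (subst (2 ≤_) (≡-sym (*-identityˡ (m + n))) (≤-trans (n≤1+n 2) 3≤m+n)) ⟩
    2 ∎
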